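{- For every $k \in \mathbb{N}$, the sequence of positive integers $$\left(\frac{\binom{n}{k}}{\left[\begin{array}{c} n \\ k \end{array}\right]}\right)_{n \geq k}, \qquad \text{where } \left[\begin{array}{c} n \\ k \end{array}\right] := \frac{\mathrm{lcm}(n, n-1, \dots, n-k+1)}{\mathrm{lcm}(1, 2, \dots, k)},$$ is periodic, and its smallest period $T_k$ is $$T_k = \prod_{p \text{ prime},\ p < k} p^{\alpha_p},$$ where for each prime $p < k$, $$\alpha_p = \begin{cases} 0 & \text{if } v_p(k) \geq \max_{1 \leq i < k} v_p(i), \\ \max_{1 \leq i < k} v_p(i) & \text{otherwise.}\end{cases}$$
   Context: $\mathbb{N}$ denotes the set of nonnegative integers. The least common multiple of the empty set is taken to be $1$. $v_p$ denotes the $p$-adic valuation. An empty product equals $1$. The quotients $\binom{n}{k}/\left[\begin{smallmatrix} n \\ k\end{smallmatrix}\right]$ are positive integers. -}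

module Defs where

open import Data.Nat using (ℕ; zero; suc; _+_; _*_; _∸_; _^_; _≤_; _<_; _⊔_)
open import Data.Nat.DivMod using (_/_)
open import Data.Nat.Divisibility using (_∣?_)
open import Data.Nat.LCM using (lcm)
open import Data.Nat.Primality using (prime?)
open import Data.Nat.Combinatorics using (_C_)
open import Data.List using (List; []; _∷_; foldr; map; upTo; filter)
open import Data.Nat.ListAction using (product)
open import Relation.Nullary using (yes; no)
open import Relation.Binary.PropositionalEquality using (_≡_)

-- Total natural-number division with the convention m // 0 = 0.
-- It is only ever applied to nonzero divisors in the statement (n ≥ k).
_//_ : ℕ → ℕ → ℕ
m // zero  = zero
m // suc d = m / suc d

lcmList : List ℕ → ℕ
lcmList = foldr lcm 1

maxList : List ℕ → ℕ
maxList = foldr _⊔_ 0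

bracket : ℕ → ℕ → ℕ
bracket n k = lcmList (map (λ i → n ∸ i) (upTo k)) // lcmList (map suc (upTo k))

quot : ℕ → ℕ → ℕ
quot k n = (n C k) // bracket n k

-- p-adic valuation v_p(n) for p ≥ 2 and n ≥ 1: the number of times p divides n.
-- (fuel-bounded recursion; fuel n suffices since v_p(n) ≤ n.)
-- Conventions for irrelevant inputs: v_0 = v_1 = 0, v_p(0) = 0.
private
  vgo : ℕ → ℕ → ℕ → ℕ
  vgo q zero    m = zero
  vgo q (suc f) zero = zero
  vgo q (suc f) (suc m) with suc (suc q) ∣? suc m
  ... | yes _ = suc (vgo q f (suc m / suc (suc q)))
  ... | no  _ = zero

v : ℕ → ℕ → ℕ
v zero          n = zero
v (suc zero)    n = zero
v (suc (suc q)) n = vgo q n n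

maxV : ℕ → ℕ → ℕ
maxV p k = maxList (map (λ i → v p i) (filter (λ i → 1 Data.Nat.≤? i) (upTo k)))

α : ℕ → ℕ → ℕ
α p k with maxV p k Data.Nat.≤? v p k
... | yes _ = 0
... | no  _ = maxV p k

T : ℕ → ℕ
T k = product (map (λ p → p ^ α p k) (filter prime? (upTo k)))

IsPeriod : (ℕ → ℕ) → ℕ → ℕ → Set
IsPeriod a k P = ∀ n → k ≤ n → a (n + P) ≡ a n

IsSmallestPeriod : (ℕ → ℕ) → ℕ → ℕ → Set
IsSmallestPeriod a k P =
  (0 < P) × IsPeriod a k P × (∀ Q → 0 < Q → IsPeriod a k Q → P ≤ Q)
  where open import Data.Product using (_×_)

{-# OPTIONS --safe #-}

-- Fix a prime p and let c_t(n) be the number of multiples of p^(t+1) among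
-- n, n-1, ..., n-k+1. Then v_p(n (n-1) ... (n-k+1)) = Σ_t c_t(n), while
-- v_p(lcm(n, ..., n-k+1)) = #{t | c_t(n) ≥ 1}. For t ≥ E = max_{i<k} v_p(i)
-- the window is too short to hold two such multiples, so the valuation
-- v_p(C(n,k) / [n k]) is Φ(n) - Φ(k), where Φ(n) = Σ_{t<E} (c_t(n) - 1).
-- Since c_t(n) = ⌊k/p^(t+1)⌋ + [n mod p^(t+1) < k mod p^(t+1)], Φ is constant
-- when p^E ∣ k and has period p^E in any case. Conversely, the periods of Φ
-- are closed under gcd; if p^E ∤ Q for a period Q, then p^(E-1) is a period,
-- and hence so is the last term [n mod p^E < k mod p^E], which is impossible
-- when p^E ∤ k. Comparing valuations prime by prime, the periods of the
-- sequence are exactly the multiples of T_k.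

module Submission where

import Algebra.Properties.CommutativeSemigroup
open import Data.Empty using (⊥-elim)
open import Data.List using ([]; _∷_; _++_; map; upTo; filter)
open import Data.List.Membership.Propositional using (_∈_)
open import Data.List.Membership.Propositional.Properties
  using (∈-upTo⁺; ∈-upTo⁻; ∈-filter⁺; ∈-filter⁻; ∈-map⁺; ∈-map⁻)
open import Data.List.Properties using (applyUpTo-∷ʳ; map-++; map-∘)
open import Data.List.Relation.Unary.All using (All; []; _∷_)
open import Data.List.Relation.Unary.Any using (here; there)
open import Data.Nat
open import Data.Nat.Combinatorics using (_C_; nCk≡nPk/k!)
open import Data.Nat.Combinatorics.Base using (_P′_)
open import Data.Nat.Combinatorics.Specification using (k!∣nP′k; nP′n≡n!; nPk≡n!/[n∸k]!; nP′k≡n!/[n∸k]!)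
open import Data.Nat.DivMod
open import Data.Nat.Divisibility
open import Data.Nat.GCD
open import Data.Nat.LCM
open import Data.Nat.ListAction using (product; sum)
open import Data.Nat.ListAction.Properties using (sum-++)
open import Data.Nat.Primality
open import Data.Nat.Primality.Factorisation using (PrimeFactorisation; factorise; factors)
open import Data.Nat.Properties
open import Data.Nat.Solver using (module +-*-Solver)
open import Data.Product using (Σ; _×_; _,_; proj₁; proj₂)
open import Data.Sum using (_⊎_; inj₁; inj₂; [_,_]′)
open import Function using (_∘_; id; case_of_)
open import Relation.Binary.Definitions using (tri<; tri≈; tri>)
open import Relation.Binary.PropositionalEquality
open import Relation.Nullary using (¬_; Dec; yes; no)

open import Defs

open Data.Nat.Primality.Factorisation.PrimeFactorisation using (isFactorisation; factorsPrime)
open Algebra.Properties.CommutativeSemigroup +-commutativeSemigroup using (interchange; xy∙z≈xz∙y)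

-- p-adic valuation

-- The metavariable vFuel
-- is solved to that helper by unification with the type of v-unfold, which
-- makes the helper available for reasoning below.
mutual
  vFuel : ℕ → ℕ → ℕ → ℕ
  vFuel q = _

  v-unfold : ∀ q m → suc (suc q) ∣ suc m →
             v (suc (suc q)) (suc m) ≡ suc (vFuel q m (suc m / suc (suc q)))
  v-unfold q m p∣m with suc (suc q) ∣? suc m
  ... | no p∤m = ⊥-elim (p∤m p∣m)
  ... | yes _ with suc m / suc (suc q)
  ...   | _ = refl

vFuel≤fuel : ∀ q f m → vFuel q f m ≤ f
vFuel≤fuel q zero    m       = z≤n
vFuel≤fuel q (suc f) zero    = z≤n
vFuel≤fuel q (suc f) (suc m) with suc (suc q) ∣? suc m
... | yes _ = s≤s (vFuel≤fuel q f _)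
... | no  _ = z≤n

vFuel-exact : ∀ q f m → 0 < m → m ≤ f →
              suc (suc q) ^ vFuel q f m ∣ m × ¬ (suc (suc q) ^ suc (vFuel q f m) ∣ m)
vFuel-exact q zero    m       0<m m≤0 = ⊥-elim (<⇒≱ 0<m m≤0)
vFuel-exact q (suc f) (suc m) _   m≤f with suc (suc q) ∣? suc m
... | no p∤m = 1∣ suc m , λ p^1∣m → p∤m (subst (_∣ suc m) (*-identityʳ _) p^1∣m)
... | yes p∣m = subst (p ^ suc e ∣_) eq (*-monoʳ-∣ p (proj₁ ih))
              , λ p^2+e∣m → proj₂ ih (*-cancelˡ-∣ p (subst (p ^ suc (suc e) ∣_) (sym eq) p^2+e∣m))
  where
  p : ℕ
  p = suc (suc q)
  m′ : ℕ
  m′ = suc m / p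
  eq : p * m′ ≡ suc m
  eq = m*[n/m]≡n p∣m
  0<m′ : 0 < m′
  0<m′ = m≥n⇒m/n>0 (∣⇒≤ p∣m)
  e : ℕ
  e = vFuel q f m′
  ih : p ^ e ∣ m′ × ¬ (p ^ suc e ∣ m′)
  ih = vFuel-exact q f m′ 0<m′ (≤-pred (≤-trans (m/n<m (suc m) p (s≤s (s≤s z≤n))) m≤f))

v-exact : ∀ {p n} → 1 < p → 0 < n → p ^ v p n ∣ n × ¬ (p ^ suc (v p n) ∣ n)
v-exact {suc zero}    (s≤s ())
v-exact {suc (suc q)} {n} _ 0<n = vFuel-exact q n n 0<n ≤-refl

v≤n : ∀ p n → v p n ≤ n
v≤n zero          n = z≤n
v≤n (suc zero)    n = z≤n
v≤n (suc (suc q)) n = vFuel≤fuel q n n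

v-1 : ∀ p → v p 1 ≡ 0
v-1 zero          = refl
v-1 (suc zero)    = refl
v-1 (suc (suc q)) = refl

^-monoʳ-∣ : ∀ p {m n} → m ≤ n → p ^ m ∣ p ^ n
^-monoʳ-∣ p {m} {n} m≤n = divides (p ^ (n ∸ m)) (begin
  p ^ n             ≡⟨ cong (p ^_) (sym (m∸n+n≡m m≤n)) ⟩
  p ^ (n ∸ m + m)   ≡⟨ ^-distribˡ-+-* p (n ∸ m) m ⟩
  p ^ (n ∸ m) * p ^ m ∎)
  where open ≡-Reasoning

^∣⇒≤v : ∀ {p n t} → 1 < p → 0 < n → p ^ t ∣ n → t ≤ v p n
^∣⇒≤v {p} {n} {t} 1<p 0<n p^t∣n with t ≤? v p n
... | yes t≤v = t≤v
... | no  t≰v = ⊥-elim (proj₂ (v-exact 1<p 0<n) (∣-trans (^-monoʳ-∣ p (≰⇒> t≰v)) p^t∣n))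

≤v⇒^∣ : ∀ {p n t} → 1 < p → 0 < n → t ≤ v p n → p ^ t ∣ n
≤v⇒^∣ {p} 1<p 0<n t≤v = ∣-trans (^-monoʳ-∣ p t≤v) (proj₁ (v-exact 1<p 0<n))

v-unique : ∀ {p n e} → 1 < p → 0 < n → p ^ e ∣ n → ¬ (p ^ suc e ∣ n) → v p n ≡ e
v-unique 1<p 0<n p^e∣n p^1+e∤n = ≤-antisym
  (≮⇒≥ (λ e<v → p^1+e∤n (≤v⇒^∣ 1<p 0<n e<v)))
  (^∣⇒≤v 1<p 0<n p^e∣n)

∣⇒v≤v : ∀ {p a b} → 1 < p → 0 < a → 0 < b → a ∣ b → v p a ≤ v p b
∣⇒v≤v 1<p 0<a 0<b a∣b = ^∣⇒≤v 1<p 0<b (∣-trans (proj₁ (v-exact 1<p 0<a)) a∣b)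

prime⇒1< : ∀ {p} → Prime p → 1 < p
prime⇒1< {p} pp = nonTrivial⇒n>1 p {{prime⇒nonTrivial pp}}

*-pos : ∀ {m n} → 0 < m → 0 < n → 0 < m * n
*-pos {suc m} {suc n} _ _ = s≤s z≤n

gcd-pos : ∀ {a} b → 0 < a → 0 < gcd a b
gcd-pos {a} b 0<a = n≢0⇒n>0 (gcd[m,n]≢0 a b (inj₁ (n>0⇒n≢0 0<a)))

v-* : ∀ {p} a b → Prime p → 0 < a → 0 < b → v p (a * b) ≡ v p a + v p b
v-* {p} a b pp 0<a 0<b = v-unique 1<p (*-pos 0<a 0<b)
  (subst (p ^ (i + j) ∣_) (sym ab≡) (m∣m*n (a′ * b′)))
  p^1+i+j∤ab
  where
  1<p : 1 < p
  1<p = prime⇒1< pp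
  i : ℕ
  i = v p a
  j : ℕ
  j = v p b
  instance _ = m^n≢0 p (i + j) {{prime⇒nonZero pp}}
  a′ : ℕ
  a′ = quotient (proj₁ (v-exact {p} {a} 1<p 0<a))
  b′ : ℕ
  b′ = quotient (proj₁ (v-exact {p} {b} 1<p 0<b))
  a≡ : a ≡ a′ * p ^ i
  a≡ = m∣n⇒n≡quotient*m (proj₁ (v-exact 1<p 0<a))
  b≡ : b ≡ b′ * p ^ j
  b≡ = m∣n⇒n≡quotient*m (proj₁ (v-exact 1<p 0<b))
  p∤a′ : ¬ (p ∣ a′)
  p∤a′ p∣a′ = proj₂ (v-exact 1<p 0<a)
    (subst (p ^ suc i ∣_) (sym a≡) (*-monoˡ-∣ (p ^ i) p∣a′))
  p∤b′ : ¬ (p ∣ b′)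
  p∤b′ p∣b′ = proj₂ (v-exact 1<p 0<b)
    (subst (p ^ suc j ∣_) (sym b≡) (*-monoˡ-∣ (p ^ j) p∣b′))
  ab≡ : a * b ≡ p ^ (i + j) * (a′ * b′)
  ab≡ = begin
    a * b                       ≡⟨ cong₂ _*_ a≡ b≡ ⟩
    a′ * p ^ i * (b′ * p ^ j)    ≡⟨ rearrange a′ b′ (p ^ i) (p ^ j) ⟩
    p ^ i * p ^ j * (a′ * b′)    ≡⟨ cong (_* (a′ * b′)) (sym (^-distribˡ-+-* p i j)) ⟩
    p ^ (i + j) * (a′ * b′)      ∎
    where
    open ≡-Reasoning
    open +-*-Solver
    rearrange : ∀ a′ b′ x y → a′ * x * (b′ * y) ≡ x * y * (a′ * b′)
    rearrange = solve 4 (λ a′ b′ x y → a′ :* x :* (b′ :* y) := x :* y :* (a′ :* b′)) refl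
  p^1+i+j∤ab : ¬ (p ^ suc (i + j) ∣ a * b)
  p^1+i+j∤ab h = [ p∤a′ , p∤b′ ]′ (euclidsLemma a′ b′ pp
    (*-cancelˡ-∣ (p ^ (i + j)) (subst₂ _∣_ (*-comm p (p ^ (i + j))) ab≡ h)))

v-gcd : ∀ {p} a b → 1 < p → 0 < a → 0 < b → v p (gcd a b) ≡ v p a ⊓ v p b
v-gcd {p} a b 1<p 0<a 0<b = ≤-antisym
  (⊓-glb (∣⇒v≤v 1<p 0<g 0<a (gcd[m,n]∣m a b)) (∣⇒v≤v 1<p 0<g 0<b (gcd[m,n]∣n a b)))
  (^∣⇒≤v 1<p 0<g (gcd-greatest (≤v⇒^∣ 1<p 0<a (m⊓n≤m (v p a) (v p b)))
                                (≤v⇒^∣ 1<p 0<b (m⊓n≤n (v p a) (v p b)))))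
  where
  0<g : 0 < gcd a b
  0<g = gcd-pos b 0<a

lcm-pos : ∀ {a b} → 0 < a → 0 < b → 0 < lcm a b
lcm-pos {a} {b} 0<a 0<b = n≢0⇒n>0 λ lcm≡0 → n>0⇒n≢0 (*-pos 0<a 0<b) (begin
  a * b               ≡⟨ sym (gcd*lcm a b) ⟩
  gcd a b * lcm a b   ≡⟨ cong (gcd a b *_) lcm≡0 ⟩
  gcd a b * 0         ≡⟨ *-zeroʳ (gcd a b) ⟩
  0                   ∎)
  where open ≡-Reasoning

m⊓n+m⊔n≡m+n : ∀ m n → m ⊓ n + (m ⊔ n) ≡ m + n
m⊓n+m⊔n≡m+n m n with ≤-total m n
... | inj₁ m≤n = cong₂ _+_ (m≤n⇒m⊓n≡m m≤n) (m≤n⇒m⊔n≡n {m} m≤n)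
... | inj₂ n≤m = trans (cong₂ _+_ (m≥n⇒m⊓n≡n {m} n≤m) (m≥n⇒m⊔n≡m n≤m)) (+-comm n m)

v-lcm : ∀ {p} a b → Prime p → 0 < a → 0 < b → v p (lcm a b) ≡ v p a ⊔ v p b
v-lcm {p} a b pp 0<a 0<b = +-cancelˡ-≡ (v p a ⊓ v p b) _ _ (begin
  v p a ⊓ v p b + v p (lcm a b)    ≡⟨ cong (_+ v p (lcm a b)) (sym (v-gcd a b (prime⇒1< pp) 0<a 0<b)) ⟩
  v p (gcd a b) + v p (lcm a b)    ≡⟨ sym (v-* (gcd a b) (lcm a b) pp 0<g (lcm-pos 0<a 0<b)) ⟩
  v p (gcd a b * lcm a b)          ≡⟨ cong (v p) (gcd*lcm a b) ⟩
  v p (a * b)                      ≡⟨ v-* a b pp 0<a 0<b ⟩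
  v p a + v p b                    ≡⟨ sym (m⊓n+m⊔n≡m+n (v p a) (v p b)) ⟩
  v p a ⊓ v p b + (v p a ⊔ v p b)  ∎)
  where
  open ≡-Reasoning
  0<g : 0 < gcd a b
  0<g = gcd-pos b 0<a

v-self : ∀ {p} → Prime p → v p p ≡ 1
v-self {p} pp = v-unique (prime⇒1< pp) 0<p (subst (_∣ p) (sym (*-identityʳ p)) ∣-refl) p^2∤p
  where
  instance _ = prime⇒nonZero pp
  0<p : 0 < p
  0<p = >-nonZero⁻¹ p
  p^2∤p : ¬ (p ^ 2 ∣ p)
  p^2∤p p^2∣p = <⇒≱ (subst (p <_) (cong (p *_) (sym (*-identityʳ p))) (m<m*n p p (prime⇒1< pp))) (∣⇒≤ p^2∣p)

v-prime-≢ : ∀ {r p} → Prime r → Prime p → r ≢ p → v r p ≡ 0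
v-prime-≢ {r} {p} pr pp r≢p = v-unique (prime⇒1< pr) (>-nonZero⁻¹ p {{prime⇒nonZero pp}}) (1∣ p) r^1∤p
  where
  r^1∤p : ¬ (r ^ 1 ∣ p)
  r^1∤p r^1∣p with prime⇒irreducible pp (subst (_∣ p) (*-identityʳ r) r^1∣p)
  ... | inj₁ r≡1 = <⇒≢ (prime⇒1< pr) (sym r≡1)
  ... | inj₂ r≡p = r≢p r≡p

v-^ : ∀ {r} p e → Prime r → 0 < p → v r (p ^ e) ≡ e * v r p
v-^ {r} p zero    pr 0<p = v-1 r
v-^ {r} p (suc e) pr 0<p = begin
  v r (p * p ^ e)        ≡⟨ v-* p (p ^ e) pr 0<p (m^n>0 p {{>-nonZero 0<p}} e) ⟩
  v r p + v r (p ^ e)    ≡⟨ cong (v r p +_) (v-^ p e pr 0<p) ⟩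
  v r p + e * v r p      ∎
  where open ≡-Reasoning

∏-∣-by-v : ∀ ps b → All Prime ps → 0 < b → (∀ r → Prime r → v r (product ps) ≤ v r b) → product ps ∣ b
∏-∣-by-v []       b _          _   _ = 1∣ b
∏-∣-by-v (p ∷ ps) b (pp ∷ pps) 0<b h =
  subst (p * product ps ∣_) (sym b≡) (*-monoʳ-∣ p (∏-∣-by-v ps b′ pps 0<b′ h′))
  where
  instance _ = prime⇒nonZero pp
  0<p : 0 < p
  0<p = >-nonZero⁻¹ p
  0<∏ : 0 < product ps
  0<∏ = productOfPrimes≥1 pps
  v[p*∏] : ∀ {r} → Prime r → v r (p * product ps) ≡ v r p + v r (product ps)
  v[p*∏] pr = v-* p (product ps) pr 0<p 0<∏
  p∣b : p ∣ b
  p∣b = subst (_∣ b) (*-identityʳ p) (≤v⇒^∣ (prime⇒1< pp) 0<b (begin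
    1                          ≡⟨ sym (v-self pp) ⟩
    v p p                      ≤⟨ m≤m+n (v p p) _ ⟩
    v p p + v p (product ps)   ≡⟨ sym (v[p*∏] pp) ⟩
    v p (p * product ps)       ≤⟨ h p pp ⟩
    v p b                      ∎))
    where open ≤-Reasoning
  b′ : ℕ
  b′ = quotient p∣b
  b≡ : b ≡ p * b′
  b≡ = m∣n⇒n≡m*quotient p∣b
  0<b′ : 0 < b′
  0<b′ = n≢0⇒n>0 λ b′≡0 → n>0⇒n≢0 0<b (trans b≡ (trans (cong (p *_) b′≡0) (*-zeroʳ p)))
  h′ : ∀ r → Prime r → v r (product ps) ≤ v r b′
  h′ r pr = +-cancelˡ-≤ (v r p) _ _ (subst₂ _≤_ (v[p*∏] pr)
    (trans (cong (v r) b≡) (v-* p b′ pr 0<p 0<b′)) (h r pr))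

v≤⇒∣ : ∀ a b → 0 < a → 0 < b → (∀ r → Prime r → v r a ≤ v r b) → a ∣ b
v≤⇒∣ a b 0<a 0<b h = subst (_∣ b) (sym a≡∏) (∏-∣-by-v (factors fa) b (factorsPrime fa) 0<b
  (λ r pr → subst (λ x → v r x ≤ v r b) a≡∏ (h r pr)))
  where
  instance _ = >-nonZero 0<a
  fa : PrimeFactorisation a
  fa = factorise a
  a≡∏ : a ≡ product (factors fa)
  a≡∏ = isFactorisation fa

v≡⇒≡ : ∀ a b → 0 < a → 0 < b → (∀ r → Prime r → v r a ≡ v r b) → a ≡ b
v≡⇒≡ a b 0<a 0<b h = ∣-antisym
  (v≤⇒∣ a b 0<a 0<b (λ r pr → ≤-reflexive (h r pr)))
  (v≤⇒∣ b a 0<b 0<a (λ r pr → ≤-reflexive (sym (h r pr))))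

v-p^ : ∀ {p} e → Prime p → v p (p ^ e) ≡ e
v-p^ {p} e pp = trans (v-^ p e pp (>-nonZero⁻¹ p {{prime⇒nonZero pp}}))
  (trans (cong (e *_) (v-self pp)) (*-identityʳ e))

v-q^ : ∀ {r p} e → Prime r → Prime p → r ≢ p → v r (p ^ e) ≡ 0
v-q^ {r} {p} e pr pp r≢p = trans (v-^ p e pr (>-nonZero⁻¹ p {{prime⇒nonZero pp}}))
  (trans (cong (e *_) (v-prime-≢ pr pp r≢p)) (*-zeroʳ e))

gcd[m,p^1+e]∣p^e : ∀ {p m} e → Prime p → 0 < m → ¬ (p ^ suc e ∣ m) → gcd m (p ^ suc e) ∣ p ^ e
gcd[m,p^1+e]∣p^e {p} {m} e pp 0<m p^1+e∤m = v≤⇒∣ _ _ 0<g (m^n>0 p e) bound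
  where
  instance _ = prime⇒nonZero pp
  0<g : 0 < gcd m (p ^ suc e)
  0<g = gcd-pos (p ^ suc e) 0<m
  v-g≡ : ∀ {r} → Prime r → v r (gcd m (p ^ suc e)) ≡ v r m ⊓ v r (p ^ suc e)
  v-g≡ pr = v-gcd m (p ^ suc e) (prime⇒1< pr) 0<m (m^n>0 p (suc e))
  bound : ∀ r → Prime r → v r (gcd m (p ^ suc e)) ≤ v r (p ^ e)
  bound r pr with r ≟ p
  ... | yes refl = begin
    v r (gcd m (r ^ suc e))    ≡⟨ v-g≡ pr ⟩
    v r m ⊓ v r (r ^ suc e)    ≤⟨ m⊓n≤m (v r m) _ ⟩
    v r m                      ≤⟨ ≤-pred (≰⇒> λ 1+e≤v → p^1+e∤m (≤v⇒^∣ (prime⇒1< pr) 0<m 1+e≤v)) ⟩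
    e                          ≡⟨ v-p^ e pr ⟨
    v r (r ^ e)                ∎
    where open ≤-Reasoning
  ... | no r≢p = begin
    v r (gcd m (p ^ suc e))    ≡⟨ v-g≡ pr ⟩
    v r m ⊓ v r (p ^ suc e)    ≤⟨ m⊓n≤n (v r m) _ ⟩
    v r (p ^ suc e)            ≡⟨ v-q^ (suc e) pr pp r≢p ⟩
    0                          ≤⟨ z≤n ⟩
    v r (p ^ e)                ∎
    where open ≤-Reasoning

χ : {A : Set} → Dec A → ℕ
χ (yes _) = 1
χ (no  _) = 0

χ≤1 : {A : Set} (a? : Dec A) → χ a? ≤ 1
χ≤1 (yes _) = s≤s z≤n
χ≤1 (no  _) = z≤n

χ-yes : {A : Set} (a? : Dec A) → A → χ a? ≡ 1
χ-yes (yes _) _ = refl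
χ-yes (no ¬a) a = ⊥-elim (¬a a)

χ-no : {A : Set} (a? : Dec A) → ¬ A → χ a? ≡ 0
χ-no (yes a) ¬a = ⊥-elim (¬a a)
χ-no (no  _) _  = refl

χ-cong : {A B : Set} (a? : Dec A) (b? : Dec B) → (A → B) → (B → A) → χ a? ≡ χ b?
χ-cong (yes a) (yes b) f g = refl
χ-cong (yes a) (no ¬b) f g = ⊥-elim (¬b (f a))
χ-cong (no ¬a) (yes b) f g = ⊥-elim (¬a (g b))
χ-cong (no ¬a) (no ¬b) f g = refl

sumBelow : (ℕ → ℕ) → ℕ → ℕ
sumBelow f zero    = 0
sumBelow f (suc k) = sumBelow f k + f k

sumBelow-cong : ∀ {f g} k → (∀ i → i < k → f i ≡ g i) → sumBelow f k ≡ sumBelow g k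
sumBelow-cong zero    h = refl
sumBelow-cong (suc k) h = cong₂ _+_ (sumBelow-cong k (λ i i<k → h i (m<n⇒m<1+n i<k))) (h k ≤-refl)

sumBelow-mono : ∀ {f g} k → (∀ i → i < k → f i ≤ g i) → sumBelow f k ≤ sumBelow g k
sumBelow-mono zero    h = z≤n
sumBelow-mono (suc k) h = +-mono-≤ (sumBelow-mono k (λ i i<k → h i (m<n⇒m<1+n i<k))) (h k ≤-refl)

sumBelow-+ : ∀ f g k → sumBelow (λ i → f i + g i) k ≡ sumBelow f k + sumBelow g k
sumBelow-+ f g zero    = refl
sumBelow-+ f g (suc k) = begin
  sumBelow (λ i → f i + g i) k + (f k + g k)   ≡⟨ cong (_+ (f k + g k)) (sumBelow-+ f g k) ⟩
  sumBelow f k + sumBelow g k + (f k + g k)     ≡⟨ interchange (sumBelow f k) (sumBelow g k) (f k) (g k) ⟩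
  sumBelow f k + f k + (sumBelow g k + g k)     ∎
  where open ≡-Reasoning

sumBelow-const-0 : ∀ {f} k → (∀ i → i < k → f i ≡ 0) → sumBelow f k ≡ 0
sumBelow-const-0 zero    h = refl
sumBelow-const-0 (suc k) h = cong₂ _+_ (sumBelow-const-0 k (λ i i<k → h i (m<n⇒m<1+n i<k))) (h k ≤-refl)

sumBelow-const-1 : ∀ {f} k → (∀ i → i < k → f i ≡ 1) → sumBelow f k ≡ k
sumBelow-const-1 zero    h = refl
sumBelow-const-1 (suc k) h =
  trans (cong₂ _+_ (sumBelow-const-1 k (λ i i<k → h i (m<n⇒m<1+n i<k))) (h k ≤-refl)) (+-comm k 1)

sumBelow-swap : ∀ (f : ℕ → ℕ → ℕ) k l →
                sumBelow (λ i → sumBelow (f i) l) k ≡ sumBelow (λ j → sumBelow (λ i → f i j) k) l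
sumBelow-swap f zero    l = sym (sumBelow-const-0 l (λ _ _ → refl))
sumBelow-swap f (suc k) l = trans (cong (_+ sumBelow (f k) l) (sumBelow-swap f k l))
  (sym (sumBelow-+ (λ j → sumBelow (λ i → f i j) k) (f k) l))

sumBelow-+-vanishing : ∀ {f} k l → (∀ i → k ≤ i → f i ≡ 0) → sumBelow f (k + l) ≡ sumBelow f k
sumBelow-+-vanishing k zero    h = cong (sumBelow _) (+-identityʳ k)
sumBelow-+-vanishing {f} k (suc l) h = begin
  sumBelow f (k + suc l)             ≡⟨ cong (sumBelow f) (+-suc k l) ⟩
  sumBelow f (k + l) + f (k + l)     ≡⟨ cong₂ _+_ (sumBelow-+-vanishing k l h) (h (k + l) (m≤m+n k l)) ⟩
  sumBelow f k + 0                   ≡⟨ +-identityʳ _ ⟩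
  sumBelow f k                       ∎
  where open ≡-Reasoning

sumBelow-single : ∀ f {r k} → (∀ i → i ≢ r → f i ≡ 0) → r < k → sumBelow f k ≡ f r
sumBelow-single f {r} {suc k} h r<1+k with r ≟ k
... | yes refl = cong (_+ f r) (sumBelow-const-0 k (λ i i<k → h i (<⇒≢ i<k)))
... | no  r≢k  = trans (cong₂ _+_ (sumBelow-single f h (≤∧≢⇒< (≤-pred r<1+k) r≢k)) (h k (r≢k ∘ sym)))
  (+-identityʳ (f r))

sumBelow-χ< : ∀ x l → x ≤ l → sumBelow (λ j → χ (j <? x)) l ≡ x
sumBelow-χ< x zero    z≤n = refl
sumBelow-χ< x (suc l) x≤1+l with m≤n⇒m<n∨m≡n x≤1+l
... | inj₂ refl = sumBelow-const-1 (suc l) (λ i i<x → χ-yes (i <? x) i<x)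
... | inj₁ x<1+l = trans (cong₂ _+_ (sumBelow-χ< x l (≤-pred x<1+l)) (χ-no (l <? x) (≤⇒≯ (≤-pred x<1+l))))
  (+-identityʳ x)

sumBelow-χ-pos⇒ : ∀ {P : ℕ → Set} (P? : ∀ i → Dec (P i)) k →
                  0 < sumBelow (λ i → χ (P? i)) k → Σ ℕ λ i → i < k × P i
sumBelow-χ-pos⇒ P? zero ()
sumBelow-χ-pos⇒ P? (suc k) pos with P? k
... | yes pk = k , ≤-refl , pk
... | no  _ with sumBelow-χ-pos⇒ P? k (subst (0 <_) (+-identityʳ _) pos)
...   | i , i<k , pi = i , m<n⇒m<1+n i<k , pi

f≤sumBelow : ∀ f {k i} → i < k → f i ≤ sumBelow f k
f≤sumBelow f {suc k} {i} i<1+k with m≤n⇒m<n∨m≡n (≤-pred i<1+k)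
... | inj₁ i<k  = ≤-trans (f≤sumBelow f i<k) (m≤m+n (sumBelow f k) (f k))
... | inj₂ refl = m≤n+m (f i) (sumBelow f k)

sumBelow-χ-pos⇐ : ∀ {P : ℕ → Set} (P? : ∀ i → Dec (P i)) {k} i → i < k → P i →
                  0 < sumBelow (λ i → χ (P? i)) k
sumBelow-χ-pos⇐ P? i i<k pi =
  ≤-trans (≤-reflexive (sym (χ-yes (P? i) pi))) (f≤sumBelow (λ i → χ (P? i)) i<k)

sum-map-upTo : ∀ f k → sum (map f (upTo k)) ≡ sumBelow f k
sum-map-upTo f zero    = refl
sum-map-upTo f (suc k) = begin
  sum (map f (upTo (suc k)))            ≡⟨ cong (sum ∘ map f) (sym (applyUpTo-∷ʳ id k)) ⟩
  sum (map f (upTo k ++ k ∷ []))        ≡⟨ cong sum (map-++ f (upTo k) (k ∷ [])) ⟩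
  sum (map f (upTo k) ++ f k ∷ [])      ≡⟨ sum-++ (map f (upTo k)) (f k ∷ []) ⟩
  sum (map f (upTo k)) + (f k + 0)      ≡⟨ cong₂ _+_ (sum-map-upTo f k) (+-identityʳ (f k)) ⟩
  sumBelow f k + f k                    ∎
  where open ≡-Reasoning

-- Multiples of d in a window of k consecutive integers

countMultiples : ℕ → ℕ → ℕ → ℕ
countMultiples d n k = sumBelow (λ i → χ (d ∣? n ∸ i)) k

module _ (d : ℕ) .{{_ : NonZero d}} where

  ∣∸⇒%≡ : ∀ n i → i ≤ n → d ∣ n ∸ i → i % d ≡ n % d
  ∣∸⇒%≡ n i i≤n (divides c n∸i≡c*d) = begin
    i % d             ≡⟨ [m+kn]%n≡m%n i c d ⟨
    (i + c * d) % d   ≡⟨ cong (λ x → (i + x) % d) n∸i≡c*d ⟨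
    (i + (n ∸ i)) % d ≡⟨ cong (_% d) (m+[n∸m]≡n i≤n) ⟩
    n % d             ∎
    where open ≡-Reasoning

  %≡⇒∣∸ : ∀ n i → i % d ≡ n % d → d ∣ n ∸ i
  %≡⇒∣∸ n i i%d≡n%d = divides (n / d ∸ i / d) (begin
    n ∸ i                                    ≡⟨ cong₂ _∸_ (m≡m%n+[m/n]*n n d) (m≡m%n+[m/n]*n i d) ⟩
    n % d + n / d * d ∸ (i % d + i / d * d)  ≡⟨ cong (λ x → n % d + n / d * d ∸ (x + i / d * d)) i%d≡n%d ⟩
    n % d + n / d * d ∸ (n % d + i / d * d)  ≡⟨ [m+n]∸[m+o]≡n∸o (n % d) _ _ ⟩
    n / d * d ∸ i / d * d                    ≡⟨ *-distribʳ-∸ d (n / d) (i / d) ⟨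
    (n / d ∸ i / d) * d                      ∎)
    where open ≡-Reasoning

  countResidue : ℕ → ℕ → ℕ
  countResidue r k = sumBelow (λ i → χ (i % d ≟ r)) k

  χ<-suc : ∀ r s → χ (r <? s) + χ (s ≟ r) ≡ χ (r <? suc s)
  χ<-suc r s with <-cmp r s
  ... | tri< r<s _ _ = trans (cong₂ _+_ (χ-yes (r <? s) r<s) (χ-no (s ≟ r) (≢-sym (<⇒≢ r<s))))
                             (sym (χ-yes (r <? suc s) (m<n⇒m<1+n r<s)))
  ... | tri≈ _ refl _ = trans (cong₂ _+_ (χ-no (r <? r) (<-irrefl refl)) (χ-yes (r ≟ r) refl))
                              (sym (χ-yes (r <? suc r) ≤-refl))
  ... | tri> _ _ s<r = trans (cong₂ _+_ (χ-no (r <? s) (<⇒≯ s<r)) (χ-no (s ≟ r) (<⇒≢ s<r)))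
                             (sym (χ-no (r <? suc s) (≤⇒≯ s<r)))

  countResidue-q*d+s : ∀ r → r < d → ∀ q s → s ≤ d → countResidue r (q * d + s) ≡ q + χ (r <? s)
  countResidue-q*d+s r r<d zero    zero    _ = sym (χ-no (r <? 0) λ ())
  countResidue-q*d+s r r<d (suc q) zero    _ = begin
    countResidue r (suc q * d + 0)    ≡⟨ cong (countResidue r) (trans (+-identityʳ _) (+-comm d (q * d))) ⟩
    countResidue r (q * d + d)        ≡⟨ countResidue-q*d+s r r<d q d ≤-refl ⟩
    q + χ (r <? d)                    ≡⟨ cong (q +_) (χ-yes (r <? d) r<d) ⟩
    q + 1                             ≡⟨ +-comm q 1 ⟩
    suc q                             ≡⟨ +-identityʳ (suc q) ⟨
    suc q + χ (r <? 0)                ∎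
    where open ≡-Reasoning
  countResidue-q*d+s r r<d q (suc s) s<d = begin
    countResidue r (q * d + suc s)                           ≡⟨ cong (countResidue r) (+-suc (q * d) s) ⟩
    countResidue r (q * d + s) + χ ((q * d + s) % d ≟ r)     ≡⟨ cong₂ _+_ (countResidue-q*d+s r r<d q s (<⇒≤ s<d))
                                                                          (cong (λ x → χ (x ≟ r)) [q*d+s]%d≡s) ⟩
    q + χ (r <? s) + χ (s ≟ r)                               ≡⟨ +-assoc q _ _ ⟩
    q + (χ (r <? s) + χ (s ≟ r))                             ≡⟨ cong (q +_) (χ<-suc r s) ⟩
    q + χ (r <? suc s)                                       ∎
    where
    open ≡-Reasoning
    [q*d+s]%d≡s : (q * d + s) % d ≡ s
    [q*d+s]%d≡s = trans (cong (_% d) (+-comm (q * d) s)) (trans ([m+kn]%n≡m%n s q d) (m<n⇒m%n≡m s<d))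

  countMultiples≡ : ∀ n k → k ≤ n → countMultiples d n k ≡ k / d + χ (n % d <? k % d)
  countMultiples≡ n k k≤n = begin
    countMultiples d n k                            ≡⟨ sumBelow-cong k (λ i i<k → χ-cong _ _
                                                         (∣∸⇒%≡ n i (≤-trans (<⇒≤ i<k) k≤n)) (%≡⇒∣∸ n i)) ⟩
    countResidue (n % d) k                          ≡⟨ cong (countResidue (n % d)) k≡ ⟩
    countResidue (n % d) (k / d * d + k % d)        ≡⟨ countResidue-q*d+s (n % d) (m%n<n n d) (k / d) (k % d) (m%n≤n k d) ⟩
    k / d + χ (n % d <? k % d)                      ∎
    where
    open ≡-Reasoning
    k≡ : k ≡ k / d * d + k % d
    k≡ = trans (m≡m%n+[m/n]*n k d) (+-comm (k % d) _)

  countMultiples-periodic : ∀ n k P → k ≤ n → d ∣ P → countMultiples d (n + P) k ≡ countMultiples d n k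
  countMultiples-periodic n k P k≤n d∣P = begin
    countMultiples d (n + P) k            ≡⟨ countMultiples≡ (n + P) k (≤-trans k≤n (m≤m+n n P)) ⟩
    k / d + χ ((n + P) % d <? k % d)      ≡⟨ cong (λ x → k / d + χ (x <? k % d)) (%-remove-+ʳ n d∣P) ⟩
    k / d + χ (n % d <? k % d)            ≡⟨ countMultiples≡ n k k≤n ⟨
    countMultiples d n k                  ∎
    where open ≡-Reasoning

  countMultiples-self : ∀ k → countMultiples d k k ≡ k / d
  countMultiples-self k = trans (countMultiples≡ k k ≤-refl)
    (trans (cong (k / d +_) (χ-no (k % d <? k % d) (<-irrefl refl))) (+-identityʳ _))

  countMultiples-mono : ∀ n k → k ≤ n → countMultiples d k k ≤ countMultiples d n k
  countMultiples-mono n k k≤n = subst₂ _≤_ (sym (countMultiples-self k)) (sym (countMultiples≡ n k k≤n))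
    (m≤m+n (k / d) _)

  countMultiples-∣ : ∀ n k → k ≤ n → d ∣ k → countMultiples d n k ≡ k / d
  countMultiples-∣ n k k≤n d∣k = trans (countMultiples≡ n k k≤n)
    (trans (cong (λ x → k / d + χ (n % d <? x)) (n∣m⇒m%n≡0 k d d∣k))
      (trans (cong (k / d +_) (χ-no (n % d <? 0) λ ())) (+-identityʳ _)))

  countMultiples-short : ∀ n k → k ≤ d → k ≤ n → countMultiples d n k ≤ 1
  countMultiples-short n k k≤d k≤n with m≤n⇒m<n∨m≡n k≤d
  ... | inj₁ k<d = subst (_≤ 1)
        (sym (trans (countMultiples≡ n k k≤n) (cong (_+ χ (n % d <? k % d)) (m<n⇒m/n≡0 k<d))))
        (χ≤1 _)
  ... | inj₂ refl = ≤-reflexive (trans (countMultiples-∣ n k k≤n ∣-refl) (n/n≡1 k))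

module _ {a : ℕ → ℕ} {k : ℕ} where

  IsPeriod-* : ∀ {P} → IsPeriod a k P → ∀ j → IsPeriod a k (j * P)
  IsPeriod-* {P} a-per zero    n k≤n = cong a (+-identityʳ n)
  IsPeriod-* {P} a-per (suc j) n k≤n = begin
    a (n + (P + j * P))   ≡⟨ cong a (trans (cong (n +_) (+-comm P (j * P))) (sym (+-assoc n (j * P) P))) ⟩
    a (n + j * P + P)     ≡⟨ a-per (n + j * P) (≤-trans k≤n (m≤m+n n (j * P))) ⟩
    a (n + j * P)         ≡⟨ IsPeriod-* a-per j n k≤n ⟩
    a n                   ∎
    where open ≡-Reasoning

  IsPeriod-∣ : ∀ {P Q} → IsPeriod a k P → P ∣ Q → IsPeriod a k Q
  IsPeriod-∣ a-per (divides j refl) = IsPeriod-* a-per j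

  -- By Bézout, gcd P Q + y Q = x P or gcd P Q + x P = y Q.
  IsPeriod-gcd : ∀ {P Q} → IsPeriod a k P → IsPeriod a k Q → IsPeriod a k (gcd P Q)
  IsPeriod-gcd {P} {Q} P-per Q-per n k≤n with Bézout.identity (gcd-GCD P Q)
  ... | Bézout.+- x y eq = begin
    a (n + gcd P Q)               ≡⟨ IsPeriod-* Q-per y (n + gcd P Q) k≤n+g ⟨
    a (n + gcd P Q + y * Q)       ≡⟨ cong a (trans (+-assoc n _ _) (cong (n +_) eq)) ⟩
    a (n + x * P)                 ≡⟨ IsPeriod-* P-per x n k≤n ⟩
    a n                           ∎
    where
    open ≡-Reasoning
    k≤n+g : k ≤ n + gcd P Q
    k≤n+g = ≤-trans k≤n (m≤m+n n (gcd P Q))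
  ... | Bézout.-+ x y eq = begin
    a (n + gcd P Q)               ≡⟨ IsPeriod-* P-per x (n + gcd P Q) k≤n+g ⟨
    a (n + gcd P Q + x * P)       ≡⟨ cong a (trans (+-assoc n _ _) (cong (n +_) eq)) ⟩
    a (n + y * Q)                 ≡⟨ IsPeriod-* Q-per y n k≤n ⟩
    a n                           ∎
    where
    open ≡-Reasoning
    k≤n+g : k ≤ n + gcd P Q
    k≤n+g = ≤-trans k≤n (m≤m+n n (gcd P Q))

-- If 0 < r < D, the indicator of n % D < r has no period 0 < s < D: at
-- n = kD it forces s < r, and then at n = kD - 1 + D it jumps from 0 to 1.
χ[%<]-aperiodic : ∀ k {D r s} .{{_ : NonZero D}} → 0 < r → r < D → 0 < s → s < D →
                  ¬ IsPeriod (λ n → χ (n % D <? r)) k s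
χ[%<]-aperiodic k {D@(suc D′)} {r} {s@(suc s′)} 0<r r<D _ s<D per = 0≢1+n (begin
  0                                      ≡⟨ χ-no (D′ <? r) (≤⇒≯ (≤-pred r<D)) ⟨
  χ (D′ <? r)                            ≡⟨ cong (λ x → χ (x <? r)) [D′+kD]%D≡D′ ⟨
  χ ((D′ + k * D) % D <? r)              ≡⟨ per (D′ + k * D) (≤-trans k≤kD (m≤n+m (k * D) D′)) ⟨
  χ ((D′ + k * D + s) % D <? r)          ≡⟨ cong (λ x → χ (x % D <? r)) D′+kD+s≡s′+[1+k]D ⟩
  χ ((s′ + suc k * D) % D <? r)          ≡⟨ cong (λ x → χ (x <? r)) [s′+[1+k]D]%D≡s′ ⟩
  χ (s′ <? r)                            ≡⟨ χ-yes (s′ <? r) (<⇒≤ s<r) ⟩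
  1                                      ∎)
  where
  open ≡-Reasoning
  k≤kD : k ≤ k * D
  k≤kD = m≤m*n k D
  [D′+kD]%D≡D′ : (D′ + k * D) % D ≡ D′
  [D′+kD]%D≡D′ = trans ([m+kn]%n≡m%n D′ k D) (m<n⇒m%n≡m ≤-refl)
  [s′+[1+k]D]%D≡s′ : (s′ + suc k * D) % D ≡ s′
  [s′+[1+k]D]%D≡s′ = trans ([m+kn]%n≡m%n s′ (suc k) D) (m<n⇒m%n≡m (m<n⇒m<1+n (≤-pred s<D)))
  [kD+s]%D≡s : (k * D + s) % D ≡ s
  [kD+s]%D≡s = trans (cong (_% D) (+-comm (k * D) s)) (trans ([m+kn]%n≡m%n s k D) (m<n⇒m%n≡m s<D))
  D′+kD+s≡s′+[1+k]D : D′ + k * D + s ≡ s′ + suc k * D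
  D′+kD+s≡s′+[1+k]D = solve 3 (λ D′ k s′ → D′ :+ k :* (con 1 :+ D′) :+ (con 1 :+ s′)
                                          := s′ :+ (con 1 :+ k) :* (con 1 :+ D′)) refl D′ k s′
    where open +-*-Solver
  s<r : s < r
  s<r = ≰⇒> λ r≤s → 0≢1+n (begin
    0                          ≡⟨ χ-no (s <? r) (≤⇒≯ r≤s) ⟨
    χ (s <? r)                 ≡⟨ cong (λ x → χ (x <? r)) [kD+s]%D≡s ⟨
    χ ((k * D + s) % D <? r)   ≡⟨ per (k * D) k≤kD ⟩
    χ ((k * D) % D <? r)       ≡⟨ cong (λ x → χ (x <? r)) (m*n%n≡0 k D) ⟩
    χ (0 <? r)                 ≡⟨ χ-yes (0 <? r) 0<r ⟩
    1                          ∎)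

module _ (f : ℕ → ℕ) where

  maxList-≥ : ∀ {xs x} → x ∈ xs → f x ≤ maxList (map f xs)
  maxList-≥ {y ∷ xs} (here refl) = m≤m⊔n (f y) _
  maxList-≥ {y ∷ xs} (there x∈xs) = ≤-trans (maxList-≥ x∈xs) (m≤n⊔m (f y) _)

  maxList-≤ : ∀ {b} xs → (∀ {x} → x ∈ xs → f x ≤ b) → maxList (map f xs) ≤ b
  maxList-≤ []       h = z≤n
  maxList-≤ (y ∷ xs) h = ⊔-lub (h (here refl)) (maxList-≤ xs (h ∘ there))

  maxList-attained : ∀ xs → maxList (map f xs) ≡ 0 ⊎ Σ ℕ λ x → x ∈ xs × maxList (map f xs) ≡ f x
  maxList-attained []       = inj₁ refl
  maxList-attained (y ∷ xs) with ⊔-sel (f y) (maxList (map f xs)) | maxList-attained xs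
  ... | inj₁ max≡fy | _                        = inj₂ (y , here refl , max≡fy)
  ... | inj₂ max≡m  | inj₁ m≡0                 = inj₁ (trans max≡m m≡0)
  ... | inj₂ max≡m  | inj₂ (x , x∈xs , m≡fx)   = inj₂ (x , there x∈xs , trans max≡m m≡fx)

  maxList-<⇒ : ∀ {t} xs → t < maxList (map f xs) → Σ ℕ λ x → x ∈ xs × t < f x
  maxList-<⇒ {t} xs t<max with maxList-attained xs
  ... | inj₁ max≡0            = ⊥-elim (n≮0 (subst (t <_) max≡0 t<max))
  ... | inj₂ (x , x∈xs , max≡fx) = x , x∈xs , subst (t <_) max≡fx t<max

lcmList-pos : ∀ xs → (∀ {x} → x ∈ xs → 0 < x) → 0 < lcmList xs
lcmList-pos []       h = s≤s z≤n
lcmList-pos (x ∷ xs) h = lcm-pos (h (here refl)) (lcmList-pos xs (h ∘ there))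

v-lcmList : ∀ {p} xs → Prime p → (∀ {x} → x ∈ xs → 0 < x) → v p (lcmList xs) ≡ maxList (map (v p) xs)
v-lcmList {p} []       pp h = v-1 p
v-lcmList {p} (x ∷ xs) pp h = trans (v-lcm x (lcmList xs) pp (h (here refl)) (lcmList-pos xs (h ∘ there)))
  (cong (v p x ⊔_) (v-lcmList xs pp (h ∘ there)))

-- The p-parts of n (n-1) ... (n-k+1) and of lcm(n, n-1, ..., n-k+1)

window-pos : ∀ {n k i} → k ≤ n → i < k → 0 < n ∸ i
window-pos k≤n i<k = m<n⇒0<n∸m (≤-trans i<k k≤n)

∈-window⇒pos : ∀ {n k x} → k ≤ n → x ∈ map (λ i → n ∸ i) (upTo k) → 0 < x
∈-window⇒pos {n} k≤n x∈ with ∈-map⁻ (λ i → n ∸ i) x∈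
... | i , i∈ , refl = window-pos k≤n (∈-upTo⁻ i∈)

∈-map-suc⇒pos : ∀ {xs x} → x ∈ map suc xs → 0 < x
∈-map-suc⇒pos x∈ with ∈-map⁻ suc x∈
... | _ , _ , refl = s≤s z≤n

v≡sumBelow-χ : ∀ {p a} l → Prime p → 0 < a → v p a ≤ l → v p a ≡ sumBelow (λ t → χ (p ^ suc t ∣? a)) l
v≡sumBelow-χ l pp 0<a v≤l = trans (sym (sumBelow-χ< _ l v≤l))
  (sumBelow-cong l (λ t _ → χ-cong _ _ (≤v⇒^∣ (prime⇒1< pp) 0<a) (^∣⇒≤v (prime⇒1< pp) 0<a)))

m≡[m∸1]+χ[1≤m] : ∀ m → m ≡ m ∸ 1 + χ (1 ≤? m)
m≡[m∸1]+χ[1≤m] zero    = refl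
m≡[m∸1]+χ[1≤m] (suc m) = +-comm 1 m

χ[1≤]-mono : ∀ {m n} → m ≤ n → χ (1 ≤? m) ≤ χ (1 ≤? n)
χ[1≤]-mono {m} {n} m≤n with 1 ≤? m
... | yes 1≤m = ≤-reflexive (sym (χ-yes (1 ≤? n) (≤-trans 1≤m m≤n)))
... | no  _   = z≤n

module AtPrime (p : ℕ) (pp : Prime p) (k : ℕ) where

  private
    1<p : 1 < p
    1<p = prime⇒1< pp
    instance
      p≢0 : NonZero p
      p≢0 = prime⇒nonZero pp

  E : ℕ
  E = maxV p k

  c : ℕ → ℕ → ℕ
  c n t = countMultiples (p ^ suc t) n k

  X : ℕ → ℕ
  X n = sumBelow (λ i → v p (n ∸ i)) k

  Y : ℕ → ℕ
  Y n = maxList (map (λ i → v p (n ∸ i)) (upTo k))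

  excessBelow : ℕ → ℕ → ℕ
  excessBelow l n = sumBelow (λ t → c n t ∸ 1) l

  Φ : ℕ → ℕ
  Φ = excessBelow E

  -- Both sides count the pairs (i, t) with p^(t+1) ∣ n - i.
  X≡sumBelow-c : ∀ n l → k ≤ n → n ≤ l → X n ≡ sumBelow (c n) l
  X≡sumBelow-c n l k≤n n≤l = trans
    (sumBelow-cong k (λ i i<k → v≡sumBelow-χ l pp (window-pos k≤n i<k)
                                   (≤-trans (v≤n p (n ∸ i)) (≤-trans (m∸n≤m n i) n≤l))))
    (sumBelow-swap (λ i t → χ (p ^ suc t ∣? n ∸ i)) k l)

  Y≡sumBelow-χc : ∀ n l → k ≤ n → n ≤ l → Y n ≡ sumBelow (λ t → χ (1 ≤? c n t)) l
  Y≡sumBelow-χc n l k≤n n≤l = trans (sym (sumBelow-χ< (Y n) l Y≤l))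
    (sumBelow-cong l (λ t _ → χ-cong _ _ (⇒ t) (⇐ t)))
    where
    f : ℕ → ℕ
    f i = v p (n ∸ i)
    Y≤l : Y n ≤ l
    Y≤l = maxList-≤ f (upTo k) (λ {i} _ → ≤-trans (v≤n p (n ∸ i)) (≤-trans (m∸n≤m n i) n≤l))
    ⇒ : ∀ t → t < Y n → 1 ≤ c n t
    ⇒ t t<Y with maxList-<⇒ f (upTo k) t<Y
    ... | i , i∈ , t<fi = sumBelow-χ-pos⇐ (λ i → p ^ suc t ∣? n ∸ i) i (∈-upTo⁻ i∈)
                            (≤v⇒^∣ 1<p (window-pos k≤n (∈-upTo⁻ i∈)) t<fi)
    ⇐ : ∀ t → 1 ≤ c n t → t < Y n
    ⇐ t 1≤c with sumBelow-χ-pos⇒ (λ i → p ^ suc t ∣? n ∸ i) k 1≤c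
    ... | i , i<k , p^1+t∣ = ≤-trans (^∣⇒≤v 1<p (window-pos k≤n i<k) p^1+t∣) (maxList-≥ f (∈-upTo⁺ i<k))

  X≡excess+Y : ∀ n l → k ≤ n → n ≤ l → X n ≡ excessBelow l n + Y n
  X≡excess+Y n l k≤n n≤l = begin
    X n                                                         ≡⟨ X≡sumBelow-c n l k≤n n≤l ⟩
    sumBelow (c n) l                                            ≡⟨ sumBelow-cong l (λ t _ → m≡[m∸1]+χ[1≤m] (c n t)) ⟩
    sumBelow (λ t → c n t ∸ 1 + χ (1 ≤? c n t)) l               ≡⟨ sumBelow-+ _ _ l ⟩
    excessBelow l n + sumBelow (λ t → χ (1 ≤? c n t)) l         ≡⟨ cong (excessBelow l n +_) (Y≡sumBelow-χc n l k≤n n≤l) ⟨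
    excessBelow l n + Y n                                       ∎
    where open ≡-Reasoning

  E≤k : E ≤ k
  E≤k = maxList-≤ (v p) (filter (1 ≤?_) (upTo k))
    (λ {x} x∈ → ≤-trans (v≤n p x) (<⇒≤ (∈-upTo⁻ (proj₁ (∈-filter⁻ (1 ≤?_) {xs = upTo k} x∈)))))

  v≤E : ∀ {i} → 0 < i → i < k → v p i ≤ E
  v≤E 0<i i<k = maxList-≥ (v p) (∈-filter⁺ (1 ≤?_) (∈-upTo⁺ i<k) 0<i)

  p^E<k : 0 < E → p ^ E < k
  p^E<k 0<E with maxList-attained (v p) (filter (1 ≤?_) (upTo k))
  ... | inj₁ E≡0 = ⊥-elim (<⇒≢ 0<E (sym E≡0))
  ... | inj₂ (i , i∈ , E≡vi) = ≤-trans (s≤s (∣⇒≤ {{>-nonZero 0<i}} (≤v⇒^∣ 1<p 0<i (≤-reflexive E≡vi)))) i<k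
    where
    0<i : 0 < i
    0<i = proj₂ (∈-filter⁻ (1 ≤?_) {xs = upTo k} i∈)
    i<k : i < k
    i<k = ∈-upTo⁻ (proj₁ (∈-filter⁻ (1 ≤?_) {xs = upTo k} i∈))

  k≤p^[1+t] : ∀ {t} → E ≤ t → k ≤ p ^ suc t
  k≤p^[1+t] {t} E≤t = ≮⇒≥ λ p^1+t<k →
    <⇒≱ (s≤s E≤t) (≤-trans (^∣⇒≤v 1<p (m^n>0 p (suc t)) ∣-refl) (v≤E (m^n>0 p (suc t)) p^1+t<k))

  X≡Φ+Y : ∀ n → k ≤ n → X n ≡ Φ n + Y n
  X≡Φ+Y n k≤n = trans (X≡excess+Y n n k≤n ≤-refl) (cong (_+ Y n) (begin
    excessBelow n n             ≡⟨ cong (λ l → excessBelow l n) (m+[n∸m]≡n E≤n) ⟨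
    excessBelow (E + (n ∸ E)) n ≡⟨ sumBelow-+-vanishing E (n ∸ E) (λ t E≤t →
                                     m≤n⇒m∸n≡0 (countMultiples-short (p ^ suc t) {{m^n≢0 p (suc t)}} n k (k≤p^[1+t] E≤t) k≤n)) ⟩
    excessBelow E n             ∎))
    where
    open ≡-Reasoning
    E≤n : E ≤ n
    E≤n = ≤-trans E≤k k≤n

  c-mono : ∀ n t → k ≤ n → c k t ≤ c n t
  c-mono n t = countMultiples-mono (p ^ suc t) {{m^n≢0 p (suc t)}} n k

  Y-mono : ∀ n → k ≤ n → Y k ≤ Y n
  Y-mono n k≤n = subst₂ _≤_ (sym (Y≡sumBelow-χc k n ≤-refl k≤n)) (sym (Y≡sumBelow-χc n n k≤n ≤-refl))
    (sumBelow-mono n (λ t _ → χ[1≤]-mono (c-mono n t k≤n)))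

  Φ-mono : ∀ n → k ≤ n → Φ k ≤ Φ n
  Φ-mono n k≤n = sumBelow-mono E (λ t _ → ∸-monoˡ-≤ 1 (c-mono n t k≤n))

  v-lcm-window : ∀ n → k ≤ n → v p (lcmList (map (λ i → n ∸ i) (upTo k))) ≡ Y n
  v-lcm-window n k≤n = trans (v-lcmList (map (λ i → n ∸ i) (upTo k)) pp (∈-window⇒pos k≤n))
    (cong maxList (sym (map-∘ (upTo k))))

  -- 1, ..., k is the window k, k-1, ..., 1 read backwards.
  v-lcm-upTo : v p (lcmList (map suc (upTo k))) ≡ Y k
  v-lcm-upTo = trans (v-lcmList (map suc (upTo k)) pp ∈-map-suc⇒pos)
    (≤-antisym (maxList-≤ (v p) _ ≤Y) (maxList-≤ _ (upTo k) ≥Y))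
    where
    k∸i≡1+[k∸1+i] : ∀ {i} → i < k → k ∸ i ≡ suc (k ∸ suc i)
    k∸i≡1+[k∸1+i] i<k = +-∸-assoc 1 i<k
    k∸1+i<k : ∀ {i} → i < k → k ∸ suc i < k
    k∸1+i<k {i} i<k = subst (_≤ k) (k∸i≡1+[k∸1+i] i<k) (m∸n≤m k i)
    ≤Y : ∀ {x} → x ∈ map suc (upTo k) → v p x ≤ Y k
    ≤Y x∈ with ∈-map⁻ suc x∈
    ... | i , i∈ , refl = subst (λ y → v p y ≤ Y k) (m∸[m∸n]≡n (∈-upTo⁻ i∈))
                            (maxList-≥ (λ i → v p (k ∸ i)) (∈-upTo⁺ (k∸1+i<k (∈-upTo⁻ i∈))))
    ≥Y : ∀ {i} → i ∈ upTo k → v p (k ∸ i) ≤ maxList (map (v p) (map suc (upTo k)))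
    ≥Y i∈ = subst (λ y → v p y ≤ maxList (map (v p) (map suc (upTo k)))) (sym (k∸i≡1+[k∸1+i] (∈-upTo⁻ i∈)))
              (maxList-≥ (v p) (∈-map⁺ suc (∈-upTo⁺ (k∸1+i<k (∈-upTo⁻ i∈)))))

  excessBelow-periodic : ∀ l P → p ^ l ∣ P → IsPeriod (excessBelow l) k P
  excessBelow-periodic l P p^l∣P n k≤n = sumBelow-cong l (λ t t<l → cong (_∸ 1)
    (countMultiples-periodic (p ^ suc t) {{m^n≢0 p (suc t)}} n k P k≤n (∣-trans (^-monoʳ-∣ p t<l) p^l∣P)))

  Φ-periodic : ∀ P → p ^ E ∣ P → IsPeriod Φ k P
  Φ-periodic = excessBelow-periodic E

  Φ-periodic-if-E≤v : E ≤ v p k → ∀ P → IsPeriod Φ k P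
  Φ-periodic-if-E≤v E≤v P n k≤n = sumBelow-cong E (λ t t<E → cong (_∸ 1)
    (trans (c≡ (n + P) (≤-trans k≤n (m≤m+n n P)) t<E) (sym (c≡ n k≤n t<E))))
    where
    c≡ : ∀ m → k ≤ m → ∀ {t} → t < E → c m t ≡ (k / p ^ suc t) {{m^n≢0 p (suc t)}}
    c≡ m k≤m {t} t<E = countMultiples-∣ (p ^ suc t) {{m^n≢0 p (suc t)}} m k k≤m
      (≤v⇒^∣ 1<p (≤-trans (s≤s z≤n) (≤-trans t<E E≤k)) (≤-trans t<E E≤v))

  p^[1+e]∣period : ∀ e → E ≡ suc e → ¬ (suc e ≤ v p k) → ∀ Q → 0 < Q → IsPeriod Φ k Q → p ^ suc e ∣ Q
  p^[1+e]∣period e E≡1+e 1+e≰v Q 0<Q Q-per with p ^ suc e ∣? Q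
  ... | yes p^1+e∣Q = p^1+e∣Q
  ... | no  p^1+e∤Q = ⊥-elim (χ[%<]-aperiodic k 0<k%D (m%n<n k D) (m^n>0 p e) p^e<D χ-per)
    where
    D : ℕ
    D = p ^ suc e
    instance
      D≢0 : NonZero D
      D≢0 = m^n≢0 p (suc e)
    D≤k : D ≤ k
    D≤k = subst (λ x → p ^ x ≤ k) E≡1+e (<⇒≤ (p^E<k (subst (0 <_) (sym E≡1+e) (s≤s z≤n))))
    0<k%D : 0 < k % D
    0<k%D = n≢0⇒n>0 λ k%D≡0 → 1+e≰v (^∣⇒≤v 1<p (≤-trans (m^n>0 p (suc e)) D≤k) (m%n≡0⇒n∣m k D k%D≡0))
    p^e<D : p ^ e < D
    p^e<D = subst (p ^ e <_) (*-comm (p ^ e) p) (m<m*n (p ^ e) p {{m^n≢0 p e}} 1<p)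
    p^e-per : IsPeriod Φ k (p ^ e)
    p^e-per = IsPeriod-∣ (IsPeriod-gcd Q-per (subst (λ x → IsPeriod Φ k (p ^ x)) E≡1+e (Φ-periodic (p ^ E) ∣-refl)))
      (gcd[m,p^1+e]∣p^e e pp 0<Q p^1+e∤Q)
    last-per : IsPeriod (λ n → c n e ∸ 1) k (p ^ e)
    last-per n k≤n = +-cancelˡ-≡ (excessBelow e n) _ _ (begin
      excessBelow e n + (c (n + p ^ e) e ∸ 1)            ≡⟨ cong (_+ (c (n + p ^ e) e ∸ 1)) (excessBelow-periodic e (p ^ e) ∣-refl n k≤n) ⟨
      excessBelow (suc e) (n + p ^ e)                    ≡⟨ cong (λ l → excessBelow l (n + p ^ e)) E≡1+e ⟨
      Φ (n + p ^ e)                                      ≡⟨ p^e-per n k≤n ⟩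
      Φ n                                                ≡⟨ cong (λ l → excessBelow l n) E≡1+e ⟩
      excessBelow e n + (c n e ∸ 1)                      ∎)
      where open ≡-Reasoning
    c∸1≡ : ∀ m → k ≤ m → c m e ∸ 1 ≡ k / D ∸ 1 + χ (m % D <? k % D)
    c∸1≡ m k≤m = trans (cong (_∸ 1) (countMultiples≡ D m k k≤m)) (+-∸-comm _ (m≥n⇒m/n>0 D≤k))
    χ-per : IsPeriod (λ n → χ (n % D <? k % D)) k (p ^ e)
    χ-per n k≤n = +-cancelˡ-≡ (k / D ∸ 1) _ _
      (trans (sym (c∸1≡ (n + p ^ e) (≤-trans k≤n (m≤m+n n _)))) (trans (last-per n k≤n) (c∸1≡ n k≤n)))

  p^E∣period : ¬ (E ≤ v p k) → ∀ Q → 0 < Q → IsPeriod Φ k Q → p ^ E ∣ Q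
  p^E∣period E≰v Q 0<Q Q-per = subst (λ x → p ^ x ∣ Q) (sym E≡1+e)
    (p^[1+e]∣period (pred E) E≡1+e (subst (λ x → ¬ (x ≤ v p k)) E≡1+e E≰v) Q 0<Q Q-per)
    where
    E≡1+e : E ≡ suc (pred E)
    E≡1+e = sym (suc-pred E {{>-nonZero (≤-trans (s≤s z≤n) (≰⇒> E≰v))}})

-- Valuations of C(n,k), [n k] and of their quotient

P′-pos : ∀ {n} j → j ≤ n → 0 < n P′ j
P′-pos zero    _   = s≤s z≤n
P′-pos (suc j) j<n = *-pos (m<n⇒0<n∸m j<n) (P′-pos j (<⇒≤ j<n))

v-P′ : ∀ {p} n j → Prime p → j ≤ n → v p (n P′ j) ≡ sumBelow (λ i → v p (n ∸ i)) j
v-P′ {p} n zero    pp _   = v-1 p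
v-P′ {p} n (suc j) pp j<n = begin
  v p ((n ∸ j) * (n P′ j))                    ≡⟨ v-* (n ∸ j) (n P′ j) pp (m<n⇒0<n∸m j<n) (P′-pos j (<⇒≤ j<n)) ⟩
  v p (n ∸ j) + v p (n P′ j)                  ≡⟨ cong (v p (n ∸ j) +_) (v-P′ n j pp (<⇒≤ j<n)) ⟩
  v p (n ∸ j) + sumBelow (λ i → v p (n ∸ i)) j ≡⟨ +-comm (v p (n ∸ j)) _ ⟩
  sumBelow (λ i → v p (n ∸ i)) j + v p (n ∸ j) ∎
  where open ≡-Reasoning

nCk*k!≡nP′k : ∀ {n k} → k ≤ n → (n C k) * k ! ≡ n P′ k
nCk*k!≡nP′k {n} {k} k≤n = trans (cong (λ x → x * k !) nCk≡nP′k/k!) (m/n*n≡m (k!∣nP′k k≤n))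
  where
  instance _ = k !≢0
  nCk≡nP′k/k! : n C k ≡ (n P′ k) / k !
  nCk≡nP′k/k! = trans (nCk≡nPk/k! k≤n)
    (cong (_/ k !) (trans (nPk≡n!/[n∸k]! k≤n) (sym (nP′k≡n!/[n∸k]! k≤n))))

m//n*n≡m : ∀ {m n} → 0 < n → n ∣ m → m // n * n ≡ m
m//n*n≡m {n = suc _} _ n∣m = m/n*n≡m n∣m

m*n>0⇒m>0 : ∀ {m n} → 0 < n → 0 < m * n → 0 < m
m*n>0⇒m>0 {suc m} _ _ = s≤s z≤n

module Quotient (k n : ℕ) (k≤n : k ≤ n) where

  private
    module A r pr = AtPrime r pr k

    window-lcm : ℕ
    window-lcm = lcmList (map (λ i → n ∸ i) (upTo k))

    upTo-lcm : ℕ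
    upTo-lcm = lcmList (map suc (upTo k))

    window-lcm-pos : 0 < window-lcm
    window-lcm-pos = lcmList-pos (map (λ i → n ∸ i) (upTo k)) (∈-window⇒pos k≤n)

    upTo-lcm-pos : 0 < upTo-lcm
    upTo-lcm-pos = lcmList-pos (map suc (upTo k)) ∈-map-suc⇒pos

    k!-pos : 0 < k !
    k!-pos = >-nonZero⁻¹ (k !) {{k !≢0}}

    bracket*upTo-lcm : bracket n k * upTo-lcm ≡ window-lcm
    bracket*upTo-lcm = m//n*n≡m upTo-lcm-pos (v≤⇒∣ _ _ upTo-lcm-pos window-lcm-pos λ r pr →
      subst₂ _≤_ (sym (A.v-lcm-upTo r pr)) (sym (A.v-lcm-window r pr n k≤n)) (A.Y-mono r pr n k≤n))

    bracket-pos : 0 < bracket n k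
    bracket-pos = m*n>0⇒m>0 upTo-lcm-pos (subst (0 <_) (sym bracket*upTo-lcm) window-lcm-pos)

    v-bracket : ∀ r (pr : Prime r) → v r (bracket n k) + A.Y r pr k ≡ A.Y r pr n
    v-bracket r pr = begin
      v r (bracket n k) + A.Y r pr k            ≡⟨ cong (v r (bracket n k) +_) (A.v-lcm-upTo r pr) ⟨
      v r (bracket n k) + v r upTo-lcm          ≡⟨ v-* (bracket n k) upTo-lcm pr bracket-pos upTo-lcm-pos ⟨
      v r (bracket n k * upTo-lcm)              ≡⟨ cong (v r) bracket*upTo-lcm ⟩
      v r window-lcm                            ≡⟨ A.v-lcm-window r pr n k≤n ⟩
      A.Y r pr n                                ∎
      where open ≡-Reasoning

    binomial-pos : 0 < n C k
    binomial-pos = m*n>0⇒m>0 k!-pos (subst (0 <_) (sym (nCk*k!≡nP′k k≤n)) (P′-pos k k≤n))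

    v-binomial : ∀ r (pr : Prime r) → v r (n C k) + A.X r pr k ≡ A.X r pr n
    v-binomial r pr = begin
      v r (n C k) + A.X r pr k                  ≡⟨ cong (v r (n C k) +_) (v-P′ k k pr ≤-refl) ⟨
      v r (n C k) + v r (k P′ k)                ≡⟨ cong (λ x → v r (n C k) + v r x) (nP′n≡n! k) ⟩
      v r (n C k) + v r (k !)                   ≡⟨ v-* (n C k) (k !) pr binomial-pos k!-pos ⟨
      v r ((n C k) * k !)                       ≡⟨ cong (v r) (nCk*k!≡nP′k k≤n) ⟩
      v r (n P′ k)                              ≡⟨ v-P′ n k pr k≤n ⟩
      A.X r pr n                                ∎
      where open ≡-Reasoning

    v-binomial≡ : ∀ r (pr : Prime r) → v r (n C k) + A.Φ r pr k ≡ A.Φ r pr n + v r (bracket n k)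
    v-binomial≡ r pr = +-cancelʳ-≡ (A.Y r pr k) _ _ (begin
      v r (n C k) + A.Φ r pr k + A.Y r pr k       ≡⟨ +-assoc (v r (n C k)) _ _ ⟩
      v r (n C k) + (A.Φ r pr k + A.Y r pr k)     ≡⟨ cong (v r (n C k) +_) (A.X≡Φ+Y r pr k ≤-refl) ⟨
      v r (n C k) + A.X r pr k                    ≡⟨ v-binomial r pr ⟩
      A.X r pr n                                  ≡⟨ A.X≡Φ+Y r pr n k≤n ⟩
      A.Φ r pr n + A.Y r pr n                     ≡⟨ cong (A.Φ r pr n +_) (v-bracket r pr) ⟨
      A.Φ r pr n + (v r (bracket n k) + A.Y r pr k) ≡⟨ +-assoc (A.Φ r pr n) _ _ ⟨
      A.Φ r pr n + v r (bracket n k) + A.Y r pr k   ∎)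
      where open ≡-Reasoning

    quot*bracket : quot k n * bracket n k ≡ n C k
    quot*bracket = m//n*n≡m bracket-pos (v≤⇒∣ _ _ bracket-pos binomial-pos λ r pr →
      +-cancelˡ-≤ (A.Φ r pr k) _ _ (begin
        A.Φ r pr k + v r (bracket n k)   ≤⟨ +-monoˡ-≤ _ (A.Φ-mono r pr n k≤n) ⟩
        A.Φ r pr n + v r (bracket n k)   ≡⟨ v-binomial≡ r pr ⟨
        v r (n C k) + A.Φ r pr k         ≡⟨ +-comm (v r (n C k)) _ ⟩
        A.Φ r pr k + v r (n C k)         ∎))
      where open ≤-Reasoning

  quot-pos : 0 < quot k n
  quot-pos = m*n>0⇒m>0 bracket-pos (subst (0 <_) (sym quot*bracket) binomial-pos)

  v-quot : ∀ r (pr : Prime r) → v r (quot k n) + A.Φ r pr k ≡ A.Φ r pr n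
  v-quot r pr = +-cancelʳ-≡ (v r (bracket n k)) _ _ (begin
    v r (quot k n) + A.Φ r pr k + v r (bracket n k)     ≡⟨ xy∙z≈xz∙y (v r (quot k n)) _ _ ⟩
    v r (quot k n) + v r (bracket n k) + A.Φ r pr k     ≡⟨ cong (_+ A.Φ r pr k) (v-* (quot k n) (bracket n k) pr quot-pos bracket-pos) ⟨
    v r (quot k n * bracket n k) + A.Φ r pr k           ≡⟨ cong (λ x → v r x + A.Φ r pr k) quot*bracket ⟩
    v r (n C k) + A.Φ r pr k                            ≡⟨ v-binomial≡ r pr ⟩
    A.Φ r pr n + v r (bracket n k)                      ∎)
    where open ≡-Reasoning

α≡0 : ∀ p k → maxV p k ≤ v p k → α p k ≡ 0
α≡0 p k E≤v with maxV p k ≤? v p k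
... | yes _   = refl
... | no  E≰v = ⊥-elim (E≰v E≤v)

α≡maxV : ∀ p k → ¬ (maxV p k ≤ v p k) → α p k ≡ maxV p k
α≡maxV p k E≰v with maxV p k ≤? v p k
... | yes E≤v = ⊥-elim (E≰v E≤v)
... | no  _   = refl

module _ (k : ℕ) where

  private
    primePower : ℕ → ℕ
    primePower p = p ^ α p k

    prime⇒0<primePower : ∀ {p} → Prime p → 0 < primePower p
    prime⇒0<primePower {p} pp = m^n>0 p {{prime⇒nonZero pp}} (α p k)

    ∏-pos : ∀ xs → 0 < product (map primePower (filter prime? xs))
    ∏-pos []       = s≤s z≤n
    ∏-pos (x ∷ xs) with prime? x
    ... | yes px = *-pos (prime⇒0<primePower px) (∏-pos xs)
    ... | no  _  = ∏-pos xs

    module _ {r} (pr : Prime r) where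

      vPrimePower : ℕ → ℕ
      vPrimePower x with prime? x
      ... | yes _ = v r (primePower x)
      ... | no  _ = 0

      v-∏ : ∀ xs → v r (product (map primePower (filter prime? xs))) ≡ sum (map vPrimePower xs)
      v-∏ []       = v-1 r
      v-∏ (x ∷ xs) with prime? x
      ... | yes px = trans (v-* (primePower x) _ pr (prime⇒0<primePower px) (∏-pos xs))
                           (cong (v r (primePower x) +_) (v-∏ xs))
      ... | no  _  = v-∏ xs

      vPrimePower-≢ : ∀ x → x ≢ r → vPrimePower x ≡ 0
      vPrimePower-≢ x x≢r with prime? x
      ... | yes px = v-q^ (α x k) pr px (x≢r ∘ sym)
      ... | no  _  = refl

      vPrimePower-self : vPrimePower r ≡ α r k
      vPrimePower-self with prime? r
      ... | yes _  = v-p^ (α r k) pr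
      ... | no ¬pr = ⊥-elim (¬pr pr)

      v-T≡sumBelow : v r (T k) ≡ sumBelow vPrimePower k
      v-T≡sumBelow = trans (v-∏ (upTo k)) (sum-map-upTo vPrimePower k)

  T-pos : 0 < T k
  T-pos = ∏-pos (upTo k)

  v-T< : ∀ {r} → Prime r → r < k → v r (T k) ≡ α r k
  v-T< pr r<k = trans (v-T≡sumBelow pr) (trans (sumBelow-single _ (vPrimePower-≢ pr) r<k) (vPrimePower-self pr))

  v-T≥ : ∀ {r} → Prime r → k ≤ r → v r (T k) ≡ 0
  v-T≥ pr k≤r = trans (v-T≡sumBelow pr) (sumBelow-const-0 k (λ i i<k →
    vPrimePower-≢ pr i (λ i≡r → <⇒≱ i<k (subst (k ≤_) (sym i≡r) k≤r))))

module _ (k : ℕ) where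

  private
    module A r pr = AtPrime r pr k

  IsPeriod-quot⇒Φ : ∀ {P} → IsPeriod (quot k) k P → ∀ r (pr : Prime r) → IsPeriod (A.Φ r pr) k P
  IsPeriod-quot⇒Φ {P} quot-per r pr n k≤n = begin
    A.Φ r pr (n + P)                    ≡⟨ Quotient.v-quot k (n + P) k≤n+P r pr ⟨
    v r (quot k (n + P)) + A.Φ r pr k   ≡⟨ cong (λ x → v r x + A.Φ r pr k) (quot-per n k≤n) ⟩
    v r (quot k n) + A.Φ r pr k         ≡⟨ Quotient.v-quot k n k≤n r pr ⟩
    A.Φ r pr n                          ∎
    where
    open ≡-Reasoning
    k≤n+P : k ≤ n + P
    k≤n+P = ≤-trans k≤n (m≤m+n n P)

  IsPeriod-Φ⇒quot : ∀ {P} → (∀ r (pr : Prime r) → IsPeriod (A.Φ r pr) k P) → IsPeriod (quot k) k P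
  IsPeriod-Φ⇒quot {P} Φ-per n k≤n = v≡⇒≡ _ _ (Quotient.quot-pos k (n + P) k≤n+P) (Quotient.quot-pos k n k≤n)
    λ r pr → +-cancelʳ-≡ (A.Φ r pr k) _ _ (begin
      v r (quot k (n + P)) + A.Φ r pr k   ≡⟨ Quotient.v-quot k (n + P) k≤n+P r pr ⟩
      A.Φ r pr (n + P)                    ≡⟨ Φ-per r pr n k≤n ⟩
      A.Φ r pr n                          ≡⟨ Quotient.v-quot k n k≤n r pr ⟨
      v r (quot k n) + A.Φ r pr k         ∎)
    where
    open ≡-Reasoning
    k≤n+P : k ≤ n + P
    k≤n+P = ≤-trans k≤n (m≤m+n n P)

  p^E∣T : ∀ {r} (pr : Prime r) → ¬ (A.E r pr ≤ v r k) → r ^ A.E r pr ∣ T k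
  p^E∣T {r} pr E≰v = ≤v⇒^∣ (prime⇒1< pr) (T-pos k)
    (≤-reflexive (sym (trans (v-T< k pr r<k) (α≡maxV r k E≰v))))
    where
    0<E : 0 < A.E r pr
    0<E = ≤-trans (s≤s z≤n) (≰⇒> E≰v)
    r<k : r < k
    r<k = ≤-trans (s≤s (subst (_≤ r ^ A.E r pr) (*-identityʳ r) (^-monoʳ-≤ r {{prime⇒nonZero pr}} 0<E)))
                  (A.p^E<k r pr 0<E)

  T-isPeriod : IsPeriod (quot k) k (T k)
  T-isPeriod = IsPeriod-Φ⇒quot λ r pr → case maxV r k ≤? v r k of λ where
    (yes E≤v) → A.Φ-periodic-if-E≤v r pr E≤v (T k)
    (no  E≰v) → A.Φ-periodic r pr (T k) (p^E∣T pr E≰v)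

  T∣period : ∀ {Q} → 0 < Q → IsPeriod (quot k) k Q → T k ∣ Q
  T∣period {Q} 0<Q quot-per = v≤⇒∣ (T k) Q (T-pos k) 0<Q v-T≤v-Q
    where
    v-T≤v-Q : ∀ r → Prime r → v r (T k) ≤ v r Q
    v-T≤v-Q r pr with r <? k | maxV r k ≤? v r k
    ... | no  r≮k | _       = subst (_≤ v r Q) (sym (v-T≥ k pr (≮⇒≥ r≮k))) z≤n
    ... | yes r<k | yes E≤v = subst (_≤ v r Q) (sym (trans (v-T< k pr r<k) (α≡0 r k E≤v))) z≤n
    ... | yes r<k | no  E≰v = subst (_≤ v r Q) (sym (trans (v-T< k pr r<k) (α≡maxV r k E≰v)))
      (^∣⇒≤v (prime⇒1< pr) 0<Q (A.p^E∣period r pr E≰v Q 0<Q (IsPeriod-quot⇒Φ quot-per r pr)))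

theorem2 : ∀ (k : ℕ) → IsSmallestPeriod (quot k) k (T k)
theorem2 k = T-pos k , T-isPeriod k , λ Q 0<Q Q-per → ∣⇒≤ {{>-nonZero 0<Q}} (T∣period k 0<Q Q-per)
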